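{- For every three vertices $x,y,z$ of a pseudo-modular graph $G$ there exist three shortest paths $P(z,y)$, $P(x,z)$, $P(x,y)$ connecting them such that either (1) there is a common vertex $v$ in $P(z,y)\cap P(x,z)\cap P(x,y)$, or (2) there is a triangle with vertices $x',y',z'$ in $G$ with edge $z'y'$ on $P(z,y)$, edge $x'z'$ on $P(x,z)$ and edge $x'y'$ on $P(x,y)$. Furthermore, (1) is true if and only if $(x|y)_z$ is an integer and $(x|y)_z=d(z,v)$, and (2) is true if and only if $(x|y)_z$ is a half-integer and $\lfloor (x|y)_z\rfloor = d(z,z')$.
   Context: Graphs are finite, connected, unweighted, undirected and simple; $d$ is the shortest-path distance, and $D(v,r)=\{u: d(u,v)\le r\}$. A graph is pseudo-modular if every family of three pairwise intersecting disks has a common vertex. The Gromov product is $(x|y)_z=\frac12(d(x,z)+d(y,z)-d(x,y))$. -}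

module Defs where

open import Data.Nat using (ℕ; zero; suc; _+_; _*_; _∸_; _≤_; ⌊_/2⌋)
open import Data.Nat.Divisibility using (_∣_)
open import Data.Fin using (Fin)
open import Data.Product using (Σ; ∃; _×_; _,_)
open import Data.Sum using (_⊎_)
open import Data.Empty using (⊥)
open import Relation.Nullary using (¬_)
open import Relation.Binary.PropositionalEquality using (_≡_)

record Graph : Set₁ where
  field
    n       : ℕ
    E       : Fin n → Fin n → Set
    E-sym   : ∀ {u v} → E u v → E v u
    E-irrefl : ∀ {u} → ¬ E u u

module _ (G : Graph) where
  open Graph G

  V : Set
  V = Fin n

  data Walk : V → V → Set where
    nil  : (u : V) → Walk u u
    cons : (u : V) {w v : V} → E u w → Walk w v → Walk u v

  len : ∀ {u v} → Walk u v → ℕ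
  len (nil _) = 0
  len (cons _ _ p) = suc (len p)

  data OnWalk (a : V) : ∀ {u v} → Walk u v → Set where
    here-nil  : OnWalk a (nil a)
    here-cons : ∀ {w v} (e : E a w) (p : Walk w v) → OnWalk a (cons a e p)
    there     : ∀ {u w v} (e : E u w) (p : Walk w v) → OnWalk a p → OnWalk a (cons u e p)

  -- a is immediately followed by b on the walk (the edge ab lies on it,
  -- traversed from a to b in the direction of the walk)
  data EdgeOn (a b : V) : ∀ {u v} → Walk u v → Set where
    here  : ∀ {v} (e : E a b) (p : Walk b v) → EdgeOn a b (cons a e p)
    there : ∀ {u w v} (e : E u w) (p : Walk w v) → EdgeOn a b p → EdgeOn a b (cons u e p)

  Connected : Set
  Connected = ∀ u v → Walk u v

  IsDist : V → V → ℕ → Set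
  IsDist u v k = (Σ (Walk u v) λ p → len p ≡ k) × (∀ (p : Walk u v) → k ≤ len p)

  IsDistance : (V → V → ℕ) → Set
  IsDistance d = ∀ u v → IsDist u v (d u v)

  module _ (d : V → V → ℕ) where

    InDisk : V → ℕ → V → Set
    InDisk v r u = d u v ≤ r

    Intersect : V → ℕ → V → ℕ → Set
    Intersect v r w s = ∃ λ u → InDisk v r u × InDisk w s u

    PseudoModular : Set
    PseudoModular = ∀ (v₁ v₂ v₃ : V) (r₁ r₂ r₃ : ℕ) →
      Intersect v₁ r₁ v₂ r₂ → Intersect v₁ r₁ v₃ r₃ → Intersect v₂ r₂ v₃ r₃ →
      ∃ λ u → InDisk v₁ r₁ u × InDisk v₂ r₂ u × InDisk v₃ r₃ u

    Geodesic : V → V → Set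
    Geodesic u v = Σ (Walk u v) λ p → len p ≡ d u v

    -- twice the Gromov product (x|y)_z = (d(x,z)+d(y,z)-d(x,y))/2
    -- (truncated subtraction is exact by the triangle inequality)
    gromov2 : V → V → V → ℕ
    gromov2 x y z = d x z + d y z ∸ d x y

    GromovInteger : V → V → V → Set
    GromovInteger x y z = 2 ∣ gromov2 x y z

    GromovHalfInteger : V → V → V → Set
    GromovHalfInteger x y z = ¬ (2 ∣ gromov2 x y z)

    ⌊gromov⌋ : V → V → V → ℕ
    ⌊gromov⌋ x y z = ⌊ gromov2 x y z /2⌋

    CommonVertex : ∀ {x y z} → Walk z y → Walk x z → Walk x y → V → Set
    CommonVertex pzy pxz pxy v = OnWalk v pzy × OnWalk v pxz × OnWalk v pxy

    TriangleOn : ∀ {x y z} → Walk z y → Walk x z → Walk x y → V → V → V → Set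
    TriangleOn pzy pxz pxy x' y' z' =
      E x' y' × E y' z' × E x' z' ×
      EdgeOn z' y' pzy × EdgeOn x' z' pxz × EdgeOn x' y' pxy

-- Let 2c = d(x,z) + d(y,z) - d(x,y). If this is even, the triangle x y z is isometric
-- to a tripod with legs a, b, c (a + b = d(x,y), a + c = d(x,z), b + c = d(y,z)), and
-- pseudo-modularity applied to D(x,a), D(y,b), D(z,c) yields a vertex v at exactly
-- these distances; geodesics through v give (1). If it is odd, the tripod has legs
-- a+1, b+1, c, and three successive applications of pseudo-modularity produce
-- vertices z', x', y' at pairwise distance 1 on the legs; geodesics through the edges
-- of x'y'z' give (2). Conversely, a common vertex v forces 2(x|y)_z = 2 d(z,v), and a
-- triangle forces 2(x|y)_z = 2 d(z,z') + 1, so the two cases are told apart by parity.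
module Submission where

open import Defs
open import Data.Nat using (ℕ; zero; suc; _+_; _*_; _∸_; _≤_; _≤?_; z≤n; s≤s; ⌊_/2⌋; ⌈_/2⌉)
open import Data.Nat.Properties
open import Data.Nat.Divisibility using (_∣_; divides; m∣m*n)
open import Data.Nat.Tactic.RingSolver using (solve-∀)
open import Data.Product using (Σ; Σ-syntax; ∃; ∃₂; _×_; _,_; proj₁; proj₂)
open import Data.Sum using (_⊎_; inj₁; inj₂; [_,_]′)
open import Data.Empty using (⊥-elim)
open import Function using (id; _∘_)
open import Relation.Nullary using (¬_; yes; no)
open import Relation.Binary.PropositionalEquality
  using (_≡_; refl; sym; trans; cong; cong₂; subst; module ≡-Reasoning)

squeeze : ∀ {a b r s} → a ≤ r → b ≤ s → r + s ≤ a + b → a ≡ r × b ≡ s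
squeeze {a} {b} {r} {s} a≤r b≤s r+s≤a+b =
  ≤-antisym a≤r (+-cancelʳ-≤ s r a (≤-trans r+s≤a+b (+-monoʳ-≤ a b≤s))) ,
  ≤-antisym b≤s (+-cancelˡ-≤ r s b (≤-trans r+s≤a+b (+-monoˡ-≤ b a≤r)))

parity : ∀ n → ∃ λ q → n ≡ 2 * q ⊎ n ≡ suc (2 * q)
parity zero = 0 , inj₁ refl
parity (suc n) with parity n
... | q , inj₁ even = q , inj₂ (cong suc even)
... | q , inj₂ odd  = suc q , inj₁ (cong suc (trans odd (sym (+-suc q (q + 0)))))

2∤odd : ∀ q → ¬ 2 ∣ suc (2 * q)
2∤odd q (divides k odd) = even≢odd k q (trans (*-comm 2 k) (sym odd))

⌊odd/2⌋ : ∀ q → ⌊ suc (2 * q) /2⌋ ≡ q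
⌊odd/2⌋ q = sym (trans (n≡⌈n+n/2⌉ q) (cong (⌈_/2⌉ ∘ (q +_)) (sym (+-identityʳ q))))

tripod-legs : ∀ {A B C} k → A ≤ C + B → B ≤ C + A → A + B ≡ C + 2 * k →
  ∃₂ λ a b → a + k ≡ A × b + k ≡ B × a + b ≡ C
tripod-legs {A} {B} {C} k A≤C+B B≤C+A sides =
  A ∸ k , B ∸ k , m∸n+n≡m k≤A , m∸n+n≡m k≤B ,
  +-cancelʳ-≡ (2 * k) _ _ (begin
    (A ∸ k + (B ∸ k)) + 2 * k   ≡⟨ interchange (A ∸ k) (B ∸ k) k ⟩
    (A ∸ k + k) + (B ∸ k + k)   ≡⟨ cong₂ _+_ (m∸n+n≡m k≤A) (m∸n+n≡m k≤B) ⟩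
    A + B                       ≡⟨ sides ⟩
    C + 2 * k                   ∎)
  where
  open ≡-Reasoning
  interchange : ∀ a b k → (a + b) + 2 * k ≡ (a + k) + (b + k)
  interchange = solve-∀
  double : ∀ A C → A + (C + A) ≡ C + 2 * A
  double = solve-∀
  leg≤side : ∀ {A B} → B ≤ C + A → A + B ≡ C + 2 * k → k ≤ A
  leg≤side {A} {B} B≤C+A sides = *-cancelˡ-≤ 2 (+-cancelˡ-≤ C _ _
    (≤-trans (≤-reflexive (sym sides)) (≤-trans (+-monoʳ-≤ A B≤C+A) (≤-reflexive (double A C)))))
  k≤A : k ≤ A
  k≤A = leg≤side B≤C+A sides
  k≤B : k ≤ B
  k≤B = leg≤side A≤C+B (trans (+-comm B A) sides)

zero-leg : ∀ {A B C b k} → b ≡ suc C → k ≡ A → b + k ≡ B → ¬ B ≤ C + A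
zero-leg refl refl refl = 1+n≰n

-- The legs are those of the even tripod over C + 1; neither can be zero, since a zero
-- leg would make one side exceed the sum of the other two.
tripod-legs-odd : ∀ {A B C} k → A ≤ C + B → B ≤ C + A → A + B ≡ C + suc (2 * k) →
  ∃₂ λ a b → suc a + k ≡ A × suc b + k ≡ B × a + suc b ≡ C
tripod-legs-odd {A} {B} {C} k A≤C+B B≤C+A sides
  with tripod-legs {A} {B} {suc C} k (m≤n⇒m≤1+n A≤C+B) (m≤n⇒m≤1+n B≤C+A) (trans sides (+-suc C _))
... | zero , b , k≡A , b+k≡B , b≡1+C = ⊥-elim (zero-leg b≡1+C k≡A b+k≡B B≤C+A)
... | suc a , zero , a+k≡A , k≡B , a+0≡1+C =
  ⊥-elim (zero-leg (trans (sym (+-identityʳ (suc a))) a+0≡1+C) k≡B a+k≡A A≤C+B)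
... | suc a , suc b , a+k≡A , b+k≡B , a+b≡C = a , b , a+k≡A , b+k≡B , suc-injective a+b≡C

gromov-of-legs : ∀ {A B C} a b c c′ → a + c ≡ A → c′ + b ≡ B → a + b ≡ C → A + B ∸ C ≡ c + c′
gromov-of-legs a b c c′ refl refl refl = begin
  (a + c) + (c′ + b) ∸ (a + b)   ≡⟨ cong (_∸ (a + b)) (interchange a b c c′) ⟩
  (a + b) + (c + c′) ∸ (a + b)   ≡⟨ m+n∸m≡n (a + b) (c + c′) ⟩
  c + c′                         ∎
  where
  open ≡-Reasoning
  interchange : ∀ a b c c′ → (a + c) + (c′ + b) ≡ (a + b) + (c + c′)
  interchange = solve-∀

module _ {G : Graph} where
  open Graph G using (E; E-sym)

  infixr 5 _++_
  _++_ : ∀ {u v w} → Walk G u v → Walk G v w → Walk G u w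
  nil _ ++ q = q
  cons u e p ++ q = cons u e (p ++ q)

  len-++ : ∀ {u v w} (p : Walk G u v) (q : Walk G v w) → len G (p ++ q) ≡ len G p + len G q
  len-++ (nil _) q = refl
  len-++ (cons u e p) q = cong suc (len-++ p q)

  reverse : ∀ {u v} → Walk G u v → Walk G v u
  reverse (nil u) = nil u
  reverse (cons u e p) = reverse p ++ cons _ (E-sym e) (nil u)

  len-reverse : ∀ {u v} (p : Walk G u v) → len G (reverse p) ≡ len G p
  len-reverse (nil u) = refl
  len-reverse (cons u e p) =
    trans (len-++ (reverse p) _) (trans (+-comm (len G (reverse p)) 1) (cong suc (len-reverse p)))

  onWalk-++ : ∀ {u v w} (p : Walk G u v) (q : Walk G v w) → OnWalk G v (p ++ q)
  onWalk-++ (nil _) (nil _) = here-nil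
  onWalk-++ (nil _) (cons _ e q) = here-cons e q
  onWalk-++ (cons u e p) q = there e (p ++ q) (onWalk-++ p q)

  edgeOn-++ : ∀ {u a b w} (p : Walk G u a) (e : E a b) (q : Walk G b w) →
    EdgeOn G a b (p ++ cons a e q)
  edgeOn-++ (nil _) e q = here e q
  edgeOn-++ (cons u e′ p) e q = there e′ _ (edgeOn-++ p e q)

  edgeOn⇒E : ∀ {a b u v} {p : Walk G u v} → EdgeOn G a b p → E a b
  edgeOn⇒E (here e _) = e
  edgeOn⇒E (there _ _ h) = edgeOn⇒E h

  splitAt-length : ∀ {u v} (p : Walk G u v) k → k ≤ len G p →
    Σ[ w ∈ V G ] Σ[ q ∈ Walk G u w ] Σ[ q′ ∈ Walk G w v ]
      (len G q ≡ k × len G q + len G q′ ≡ len G p)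
  splitAt-length p zero _ = _ , nil _ , p , refl , refl
  splitAt-length (cons u e p) (suc k) k<len with splitAt-length p k (≤-pred k<len)
  ... | w , q , q′ , len-q , lens = w , cons u e q , q′ , cong suc len-q , cong suc lens

  splitAt-vertex : ∀ {a u v} {p : Walk G u v} → OnWalk G a p →
    Σ[ q ∈ Walk G u a ] Σ[ q′ ∈ Walk G a v ] len G q + len G q′ ≡ len G p
  splitAt-vertex here-nil = nil _ , nil _ , refl
  splitAt-vertex (here-cons e p) = nil _ , cons _ e p , refl
  splitAt-vertex (there e p h) with splitAt-vertex h
  ... | q , q′ , lens = cons _ e q , q′ , cong suc lens

  splitAt-edge : ∀ {a b u v} {p : Walk G u v} → EdgeOn G a b p →
    Σ[ q ∈ Walk G u a ] Σ[ q′ ∈ Walk G b v ] len G q + suc (len G q′) ≡ len G p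
  splitAt-edge (here e p) = nil _ , p , refl
  splitAt-edge (there e p h) with splitAt-edge h
  ... | q , q′ , lens = cons _ e q , q′ , cong suc lens

module ShortestPaths (G : Graph) (d : V G → V G → ℕ) (isDistance : IsDistance G d) where
  open Graph G using (E; E-sym)
  open ≤-Reasoning

  geodesic : ∀ u v → Walk G u v
  geodesic u v = proj₁ (proj₁ (isDistance u v))

  len-geodesic : ∀ u v → len G (geodesic u v) ≡ d u v
  len-geodesic u v = proj₂ (proj₁ (isDistance u v))

  d≤len : ∀ {u v} (p : Walk G u v) → d u v ≤ len G p
  d≤len {u} {v} = proj₂ (isDistance u v)

  d-sym-≤ : ∀ u v → d u v ≤ d v u
  d-sym-≤ u v = ≤-trans (d≤len (reverse (geodesic v u)))
    (≤-reflexive (trans (len-reverse _) (len-geodesic v u)))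

  d-sym : ∀ u v → d u v ≡ d v u
  d-sym u v = ≤-antisym (d-sym-≤ u v) (d-sym-≤ v u)

  d-triangle : ∀ u v w → d u w ≤ d u v + d v w
  d-triangle u v w = begin
    d u w                                        ≤⟨ d≤len (geodesic u v ++ geodesic v w) ⟩
    len G (geodesic u v ++ geodesic v w)         ≡⟨ len-++ (geodesic u v) (geodesic v w) ⟩
    len G (geodesic u v) + len G (geodesic v w)  ≡⟨ cong₂ _+_ (len-geodesic u v) (len-geodesic v w) ⟩
    d u v + d v w                                ∎

  d-refl : ∀ u → d u u ≡ 0
  d-refl u = n≤0⇒n≡0 (d≤len (nil u))

  d≡1⇒E : ∀ {u v} → d u v ≡ 1 → E u v
  d≡1⇒E {u} {v} d≡1 = edge (geodesic u v) (trans (len-geodesic u v) d≡1)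
    where
    edge : ∀ {u v} (p : Walk G u v) → len G p ≡ 1 → E u v
    edge (cons u e (nil _)) _ = e

  d-onGeodesic : ∀ {u v w} (p : Walk G u w) → len G p ≡ d u w → OnWalk G v p →
    d u v + d v w ≡ d u w
  d-onGeodesic {u} {v} {w} p geo v∈p with splitAt-vertex v∈p
  ... | q , q′ , lens = ≤-antisym (begin
    d u v + d v w      ≤⟨ +-mono-≤ (d≤len q) (d≤len q′) ⟩
    len G q + len G q′ ≡⟨ trans lens geo ⟩
    d u w              ∎) (d-triangle u v w)

  d-edgeOnGeodesic : ∀ {u a b w} (p : Walk G u w) → len G p ≡ d u w → EdgeOn G a b p →
    d u a + suc (d b w) ≡ d u w
  d-edgeOnGeodesic {u} {a} {b} {w} p geo ab∈p with splitAt-edge ab∈p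
  ... | q , q′ , lens = ≤-antisym (begin
    d u a + suc (d b w)        ≤⟨ +-mono-≤ (d≤len q) (s≤s (d≤len q′)) ⟩
    len G q + suc (len G q′)   ≡⟨ trans lens geo ⟩
    d u w                      ∎) (begin
    d u w
      ≤⟨ d-triangle u a w ⟩
    d u a + d a w
      ≤⟨ +-monoʳ-≤ (d u a) (d≤len (cons a (edgeOn⇒E ab∈p) (geodesic b w))) ⟩
    d u a + suc (len G (geodesic b w))
      ≡⟨ cong (λ l → d u a + suc l) (len-geodesic b w) ⟩
    d u a + suc (d b w)
      ∎)

  geodesicThrough : ∀ {u w} v {r s} → d v u ≡ r → d v w ≡ s → r + s ≡ d u w →
    Σ (Geodesic G d u w) λ P → OnWalk G v (proj₁ P)
  geodesicThrough {u} {w} v {r} {s} vu vw r+s =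
    (geodesic u v ++ geodesic v w , length) , onWalk-++ (geodesic u v) (geodesic v w)
    where
    length : len G (geodesic u v ++ geodesic v w) ≡ d u w
    length = begin-equality
      len G (geodesic u v ++ geodesic v w)
        ≡⟨ len-++ (geodesic u v) (geodesic v w) ⟩
      len G (geodesic u v) + len G (geodesic v w)
        ≡⟨ cong₂ _+_ (len-geodesic u v) (len-geodesic v w) ⟩
      d u v + d v w
        ≡⟨ cong₂ _+_ (trans (d-sym u v) vu) vw ⟩
      r + s
        ≡⟨ r+s ⟩
      d u w
        ∎

  geodesicThroughEdge : ∀ {u w a b} (e : E a b) {r s} → d a u ≡ r → d b w ≡ s → r + suc s ≡ d u w →
    Σ (Geodesic G d u w) λ P → EdgeOn G a b (proj₁ P)
  geodesicThroughEdge {u} {w} {a} {b} e {r} {s} au bw r+1+s =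
    (geodesic u a ++ cons a e (geodesic b w) , length) , edgeOn-++ (geodesic u a) e (geodesic b w)
    where
    length : len G (geodesic u a ++ cons a e (geodesic b w)) ≡ d u w
    length = begin-equality
      len G (geodesic u a ++ cons a e (geodesic b w))
        ≡⟨ len-++ (geodesic u a) _ ⟩
      len G (geodesic u a) + suc (len G (geodesic b w))
        ≡⟨ cong₂ (λ l l′ → l + suc l′) (len-geodesic u a) (len-geodesic b w) ⟩
      d u a + suc (d b w)
        ≡⟨ cong₂ (λ l l′ → l + suc l′) (trans (d-sym u a) au) bw ⟩
      r + suc s
        ≡⟨ r+1+s ⟩
      d u w
        ∎

  disks-intersect : ∀ a r b s → d a b ≤ r + s → Intersect G d a r b s
  disks-intersect a r b s ab≤r+s with d a b ≤? r
  ... | yes ab≤r = b , ≤-trans (d-sym-≤ b a) ab≤r , ≤-trans (≤-reflexive (d-refl b)) z≤n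
  ... | no ab≰r with splitAt-length (geodesic a b) r
                       (≤-trans (<⇒≤ (≰⇒> ab≰r)) (≤-reflexive (sym (len-geodesic a b))))
  ... | w , q , q′ , len-q , lens =
    w , ≤-trans (d-sym-≤ w a) (≤-trans (d≤len q) (≤-reflexive len-q)) ,
    ≤-trans (d≤len q′) (+-cancelˡ-≤ r _ _ (begin
      r + len G q′        ≡⟨ cong (_+ len G q′) (sym len-q) ⟩
      len G q + len G q′  ≡⟨ trans lens (len-geodesic a b) ⟩
      d a b               ≤⟨ ab≤r+s ⟩
      r + s               ∎))

  d-triangle′ : ∀ u v w → d v w ≤ d u v + d u w
  d-triangle′ u v w = ≤-trans (d-triangle v u w) (≤-reflexive (cong (_+ d u w) (d-sym v u)))

  gromov2-sides : ∀ x y z {g} → gromov2 G d x y z ≡ g → d x z + d y z ≡ d x y + g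
  gromov2-sides x y z refl =
    sym (m+[n∸m]≡n (≤-trans (d-triangle x z y) (≤-reflexive (cong (d x z +_) (d-sym z y)))))

  exact-distances : ∀ {u v w r s} → d u v ≤ r → d u w ≤ s → r + s ≡ d v w →
    d u v ≡ r × d u w ≡ s
  exact-distances {u} {v} {w} {r} {s} uv≤r uw≤s r+s = squeeze uv≤r uw≤s (begin
    r + s          ≡⟨ r+s ⟩
    d v w          ≤⟨ d-triangle′ u v w ⟩
    d u v + d u w  ∎)

  commonVertex⇒gromov2 : ∀ {x y z} (Pzy : Geodesic G d z y) (Pxz : Geodesic G d x z)
    (Pxy : Geodesic G d x y) {v} → CommonVertex G d (proj₁ Pzy) (proj₁ Pxz) (proj₁ Pxy) v →
    2 * d z v ≡ gromov2 G d x y z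
  commonVertex⇒gromov2 {x} {y} {z} (pzy , zy) (pxz , xz) (pxy , xy) {v} (v∈zy , v∈xz , v∈xy) =
    sym (trans
      (gromov-of-legs (d x v) (d v y) (d v z) (d z v) (d-onGeodesic pxz xz v∈xz)
        (trans (d-onGeodesic pzy zy v∈zy) (d-sym z y)) (d-onGeodesic pxy xy v∈xy))
      (cong₂ _+_ (d-sym v z) (sym (+-identityʳ (d z v)))))

  triangle⇒gromov2 : ∀ {x y z} (Pzy : Geodesic G d z y) (Pxz : Geodesic G d x z)
    (Pxy : Geodesic G d x y) {x′ y′ z′} → TriangleOn G d (proj₁ Pzy) (proj₁ Pxz) (proj₁ Pxy) x′ y′ z′ →
    gromov2 G d x y z ≡ suc (2 * d z z′)
  triangle⇒gromov2 {x} {y} {z} (pzy , zy) (pxz , xz) (pxy , xy) {x′} {y′} {z′}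
    (_ , _ , _ , z′y′∈zy , x′z′∈xz , x′y′∈xy) =
    trans
      (gromov-of-legs (d x x′) (suc (d y′ y)) (suc (d z′ z)) (d z z′) (d-edgeOnGeodesic pxz xz x′z′∈xz)
        (trans (d-edgeOnGeodesic pzy zy z′y′∈zy) (d-sym z y)) (d-edgeOnGeodesic pxy xy x′y′∈xy))
      (cong suc (cong₂ _+_ (d-sym z′ z) (sym (+-identityʳ (d z z′)))))

  gromovInteger : ∀ {x y z} (Pzy : Geodesic G d z y) (Pxz : Geodesic G d x z)
    (Pxy : Geodesic G d x y) {v} → CommonVertex G d (proj₁ Pzy) (proj₁ Pxz) (proj₁ Pxy) v →
    GromovInteger G d x y z
  gromovInteger Pzy Pxz Pxy {v} cv =
    subst (2 ∣_) (commonVertex⇒gromov2 Pzy Pxz Pxy cv) (m∣m*n (d _ v))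

  gromovHalfInteger : ∀ {x y z} (Pzy : Geodesic G d z y) (Pxz : Geodesic G d x z)
    (Pxy : Geodesic G d x y) {x′ y′ z′} → TriangleOn G d (proj₁ Pzy) (proj₁ Pxz) (proj₁ Pxy) x′ y′ z′ →
    GromovHalfInteger G d x y z
  gromovHalfInteger Pzy Pxz Pxy {z′ = z′} t =
    2∤odd (d _ z′) ∘ subst (2 ∣_) (triangle⇒gromov2 Pzy Pxz Pxy t)

  ThinGeodesicTriangle : V G → V G → V G → Set
  ThinGeodesicTriangle x y z =
    Σ (Geodesic G d z y) λ Pzy → Σ (Geodesic G d x z) λ Pxz → Σ (Geodesic G d x y) λ Pxy →
      (∃ λ v → CommonVertex G d (proj₁ Pzy) (proj₁ Pxz) (proj₁ Pxy) v) ⊎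
      (∃ λ x′ → ∃ λ y′ → ∃ λ z′ → TriangleOn G d (proj₁ Pzy) (proj₁ Pxz) (proj₁ Pxy) x′ y′ z′)

  module _ (pseudoModular : PseudoModular G d) where

    meetingPoint : ∀ v₁ v₂ v₃ r₁ r₂ r₃ → r₁ + r₂ ≡ d v₁ v₂ → r₁ + r₃ ≡ d v₁ v₃ →
      d v₂ v₃ ≤ r₂ + r₃ → ∃ λ u → d u v₁ ≡ r₁ × d u v₂ ≡ r₂ × d u v₃ ≡ r₃
    meetingPoint v₁ v₂ v₃ r₁ r₂ r₃ r₁₂ r₁₃ v₂v₃≤r₂₃
      with pseudoModular v₁ v₂ v₃ r₁ r₂ r₃
             (disks-intersect v₁ r₁ v₂ r₂ (≤-reflexive (sym r₁₂)))
             (disks-intersect v₁ r₁ v₃ r₃ (≤-reflexive (sym r₁₃)))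
             (disks-intersect v₂ r₂ v₃ r₃ v₂v₃≤r₂₃)
    ... | u , uv₁ , uv₂ , uv₃ =
      u , proj₁ (exact-distances uv₁ uv₂ r₁₂) , proj₂ (exact-distances uv₁ uv₂ r₁₂) ,
      proj₂ (exact-distances uv₁ uv₃ r₁₃)

    commonVertexCase : ∀ x y z a b c → a + c ≡ d x z → b + c ≡ d y z → a + b ≡ d x y →
      ThinGeodesicTriangle x y z
    commonVertexCase x y z a b c xz yz xy
      with meetingPoint x y z a b c xy xz (≤-reflexive (sym yz))
    ... | v , vx , vy , vz =
      let Pzy , v∈zy = geodesicThrough v vz vy (trans (+-comm c b) (trans yz (d-sym y z)))
          Pxz , v∈xz = geodesicThrough v vx vz xz
          Pxy , v∈xy = geodesicThrough v vx vy xy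
      in Pzy , Pxz , Pxy , inj₁ (v , v∈zy , v∈xz , v∈xy)

    triangleCase : ∀ x y z a b c → suc a + c ≡ d x z → suc b + c ≡ d y z → a + suc b ≡ d x y →
      ThinGeodesicTriangle x y z
    triangleCase x y z a b c xz yz xy
      with meetingPoint z x y c (suc a) (suc b) (trans (+-comm c (suc a)) (trans xz (d-sym x z)))
                              (trans (+-comm c (suc b)) (trans yz (d-sym y z)))
                              (≤-trans (≤-reflexive (sym xy)) (n≤1+n _))
    ... | z′ , z′z , z′x , z′y
      with meetingPoint x z′ y a 1 (suc b) (trans (+-comm a 1) (trans (sym z′x) (d-sym z′ x))) xy
                               (≤-trans (≤-reflexive z′y) (n≤1+n _))
    ... | x′ , x′x , x′z′ , x′y
      with meetingPoint y x′ z′ b 1 1 (trans (+-comm b 1) (trans (sym x′y) (d-sym x′ y)))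
                                (trans (+-comm b 1) (trans (sym z′y) (d-sym z′ y)))
                                (≤-trans (≤-reflexive x′z′) (n≤1+n 1))
    ... | y′ , y′y , y′x′ , y′z′ =
      let x′y′ = E-sym (d≡1⇒E y′x′)
          y′z′ = d≡1⇒E y′z′
          x′z′ = d≡1⇒E x′z′
          Pzy , z′y′∈zy = geodesicThroughEdge (E-sym y′z′) z′z y′y
                            (trans (+-comm c (suc b)) (trans yz (d-sym y z)))
          Pxz , x′z′∈xz = geodesicThroughEdge x′z′ x′x z′z (trans (+-suc a c) xz)
          Pxy , x′y′∈xy = geodesicThroughEdge x′y′ x′x y′y xy
      in Pzy , Pxz , Pxy ,
         inj₂ (x′ , y′ , z′ , x′y′ , y′z′ , x′z′ , z′y′∈zy , x′z′∈xz , x′y′∈xy)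

    thinGeodesicTriangle : ∀ x y z → ThinGeodesicTriangle x y z
    thinGeodesicTriangle x y z with parity (gromov2 G d x y z)
    ... | k , inj₁ even
      with tripod-legs k (d-triangle x y z) (d-triangle′ x y z) (gromov2-sides x y z even)
    ... | a , b , xz , yz , xy = commonVertexCase x y z a b k xz yz xy
    thinGeodesicTriangle x y z | k , inj₂ odd
      with tripod-legs-odd k (d-triangle x y z) (d-triangle′ x y z) (gromov2-sides x y z odd)
    ... | a , b , xz , yz , xy = triangleCase x y z a b k xz yz xy

lemma2 : (G : Graph) → Connected G → (d : V G → V G → ℕ) → IsDistance G d → PseudoModular G d →
    (x y z : V G) →
    Σ (Geodesic G d z y) λ Pzy → Σ (Geodesic G d x z) λ Pxz → Σ (Geodesic G d x y) λ Pxy →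
    let pzy = proj₁ Pzy
        pxz = proj₁ Pxz
        pxy = proj₁ Pxy
        C1 = ∃ λ v → CommonVertex G d pzy pxz pxy v
        C2 = ∃ λ x' → ∃ λ y' → ∃ λ z' → TriangleOn G d pzy pxz pxy x' y' z'
    in (C1 ⊎ C2)
       × ((C1 → GromovInteger G d x y z × (∀ v → CommonVertex G d pzy pxz pxy v → 2 * d z v ≡ gromov2 G d x y z))
          × (GromovInteger G d x y z → C1))
       × ((C2 → GromovHalfInteger G d x y z × (∀ x' y' z' → TriangleOn G d pzy pxz pxy x' y' z' → ⌊gromov⌋ G d x y z ≡ d z z'))
          × (GromovHalfInteger G d x y z → C2))
lemma2 G _ d isDistance pseudoModular x y z
  with ShortestPaths.thinGeodesicTriangle G d isDistance pseudoModular x y z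
... | Pzy , Pxz , Pxy , vertex⊎triangle =
  Pzy , Pxz , Pxy , vertex⊎triangle ,
  ((λ (_ , cv) → integer cv , λ _ → commonVertex⇒gromov2 Pzy Pxz Pxy) ,
   λ int → [ id , (λ (_ , _ , _ , t) → ⊥-elim (halfInteger t int)) ]′ vertex⊎triangle) ,
  ((λ (_ , _ , _ , t) → halfInteger t ,
      λ _ _ z′ t → trans (cong ⌊_/2⌋ (triangle⇒gromov2 Pzy Pxz Pxy t)) (⌊odd/2⌋ (d z z′))) ,
   λ halfInt → [ (λ (_ , cv) → ⊥-elim (halfInt (integer cv))) , id ]′ vertex⊎triangle)
  where
  open ShortestPaths G d isDistance
  integer = gromovInteger Pzy Pxz Pxy
  halfInteger = gromovHalfInteger Pzy Pxz Pxy
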